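{- Let $\mathbf{t}$ be the Thue--Morse sequence. Then: (a) for all $n\ge 0$, $r_{\mathbf{t}}(2n+1) = \rho_{\mathbf{t}}(n + 1)$; (b) for all $n \geq 2$, \[ r_{\mathbf{t}}(2 n) = \begin{cases} \rho_{\mathbf{t}}(n+1) + 1, & \text{if there exists } m\ge 0 \text{ with } 3 \cdot 4^{m-1} + 1 \leq n \leq 4^{m}, \\ \rho_{\mathbf{t}}(n+1), & \text{otherwise}; \end{cases} \] (c) there is a deterministic finite automaton with output having $14$ states that, reading the base-$2$ representation of $n$, outputs $r_{\mathbf{t}}(n+1)-r_{\mathbf{t}}(n)$; in particular this first-difference sequence is $2$-automatic.
   Context: The Thue--Morse sequence is $\mathbf{t}=t(0)t(1)t(2)\cdots = 0110100110010110\cdots$, where $t(n)$ is the number of $1$'s in the base-$2$ expansion of $n$, taken modulo $2$. A factor is a finite contiguous block. For $u=u(1)\cdots u(m)$, $u^R=u(m)\cdots u(1)$. $\rho_{\mathbf{t}}(n)$ is the number of distinct length-$n$ factors of $\mathbf{t}$, and $r_{\mathbf{t}}(n)$ is the number of distinct length-$n$ factors up to the equivalence $u\sim v\iff v\in\{u,u^R\}$. -}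

module Defs where

open import Data.Bool using (Bool; true; false; _xor_; if_then_else_)
open import Data.Unit using (⊤)
open import Data.Nat using (ℕ; zero; suc; _+_; _*_; _≡ᵇ_)
open import Data.Nat.DivMod using (_/_; _%_)
open import Data.Fin using (Fin; toℕ)
open import Data.Integer using (ℤ)
open import Data.List using (List; []; _∷_; foldl; length)
open import Data.List.Relation.Unary.All using (All)
open import Data.List.Relation.Unary.Any using (Any)
open import Data.List.Relation.Unary.AllPairs using (AllPairs)
open import Data.Vec using (Vec; tabulate; reverse)
open import Data.Product using (Σ; _×_)
open import Data.Sum using (_⊎_)
open import Relation.Nullary using (¬_)
open import Relation.Binary.PropositionalEquality using (_≡_)

-- Base-2 expansion (least significant digit first), true = digit 1.
-- The fuel argument n is always enough since n has at most n binary digits.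

bitsFuel : ℕ → ℕ → List Bool
bitsFuel zero    _       = []
bitsFuel (suc f) zero    = []
bitsFuel (suc f) (suc m) = ((suc m % 2) ≡ᵇ 1) ∷ bitsFuel f (suc m / 2)

bits : ℕ → List Bool
bits n = bitsFuel n n

parity : List Bool → Bool
parity []       = false
parity (b ∷ bs) = b xor parity bs

t : ℕ → Bool
t n = parity (bits n)

window : (n i : ℕ) → Vec Bool n
window n i = tabulate (λ j → t (i + toℕ j))

Factor : {n : ℕ} → Vec Bool n → Set
Factor {n} w = Σ ℕ (λ i → w ≡ window n i)

RevEq : {n : ℕ} → Vec Bool n → Vec Bool n → Set
RevEq u v = (v ≡ u) ⊎ (v ≡ reverse u)

CountClasses : {A : Set} → (A → A → Set) → (A → Set) → ℕ → Set
CountClasses {A} _≈_ P k =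
  Σ (List A) λ xs →
    (length xs ≡ k) × All P xs × AllPairs (λ x y → ¬ (x ≈ y)) xs
    × ((w : A) → P w → Any (λ x → w ≈ x) xs)

IsRho : ℕ → ℕ → Set
IsRho n k = CountClasses {Vec Bool n} _≡_ Factor k

IsR : ℕ → ℕ → Set
IsR n k = CountClasses {Vec Bool n} RevEq Factor k

-- Condition of part (b): ∃ m ≥ 0 with 3·4^(m-1)+1 ≤ n ≤ 4^m.
-- (m = 0 gives an empty range, so we quantify over m = j+1.)

open import Data.Nat using (_≤_; _^_)

Cond : ℕ → Set
Cond n = Σ ℕ λ j → (3 * 4 ^ j + 1 ≤ n) × (n ≤ 4 ^ suc j)

record DFAO (Q : Set) : Set where
  field
    init  : Q
    δ     : Q → Bool → Q
    out   : Q → ℤ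

-- run on a word read most significant digit first
run : {Q : Set} → DFAO Q → List Bool → Q
run M ds = foldl (DFAO.δ M) (DFAO.init M) ds

valueMsd : List Bool → ℕ
valueMsd = foldl (λ acc b → 2 * acc + (if b then 1 else 0)) 0

-- canonical base-2 representation: no leading zero (0 is the empty word)
Canonical : List Bool → Set
Canonical []          = ⊤
Canonical (b ∷ _)     = b ≡ true

-- Windows of t desubstitute: a window of length 2n at an even position is μ u for a factor u of
-- length n, one at an odd position is μ u stripped of both end letters for a factor u of length
-- n + 1, and for length at least 5 no factor is of both kinds, since t contains no factor ababa.
-- Reversal turns μ into μ after complementation, so counting factors of length 2n up to reversal
-- means counting factors of lengths n and n + 1 up to reversed complement, and vice versa.  At
-- odd length 2n + 1 every class has a representative at an even position, because
-- t (2^K − 1 − x) = t x + K (mod 2) makes every reversed, possibly complemented, factor occur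
-- again; hence r (2n+1) = ρ (n+1).  The resulting recurrences for ρ, r and the reverse-complement
-- count s close up on finitely many profiles, which the 14-state automaton enumerates together
-- with the position of n relative to the intervals (3·2^k, 4·2^k]; the profile determines both
-- r (2n) − ρ (n+1) and r (n+1) − r n.

module Submission where

open import Defs
open import Data.Bool using (Bool; true; false; not; _xor_; if_then_else_)
open import Data.Bool.Properties using (not-involutive; not-injective; not-¬; not-distribˡ-xor)
open import Data.Empty using (⊥; ⊥-elim)
open import Data.Fin using (Fin)
import Data.Fin as Fin
import Data.Fin.Properties as Fin
open import Data.Integer using (ℤ; +_; -[1+_]; _-_)
import Data.Integer as ℤ
import Data.Integer.Properties as ℤ
open import Data.Integer.Tactic.RingSolver using () renaming (solve-∀ to ℤ-solve-∀)
open import Data.List using (List; []; _∷_; length; map; reverse; _++_; take; foldl)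
open import Data.List.Properties using (≡-dec; reverse-++; length-map; length-++; ∷-injectiveˡ; ∷-injectiveʳ)
open import Data.List.Relation.Unary.All using (all?)
import Data.List.Relation.Unary.All as All
import Data.List.Relation.Unary.All.Properties as All
open import Data.List.Relation.Unary.Any using (Any; any?)
import Data.List.Relation.Unary.Any as Any
import Data.List.Relation.Unary.Any.Properties as Any
open import Data.List.Relation.Unary.AllPairs using (AllPairs; allPairs?)
import Data.List.Relation.Unary.AllPairs as AllPairs
import Data.List.Relation.Unary.AllPairs.Properties as AllPairs
open import Data.Nat using (ℕ; zero; suc; _+_; _*_; _^_; _∸_; _≤_; _<_; z≤n; s≤s; _≡ᵇ_; _≤?_; _<?_)
open import Data.Nat.Divisibility using (divides)
open import Data.Nat.DivMod using (_/_; _%_; m*n%n≡0; m*n/n≡m; m/n<m; [m+kn]%n≡m%n; +-distrib-/-∣ʳ)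
open import Data.Nat.Induction using (<-rec)
open import Data.Nat.Properties
  using ( _≟_; *-comm; *-monoʳ-≤; +-assoc; +-comm; +-identityʳ; +-mono-≤; +-suc; <⇒≤; <⇒≱; ^-monoʳ-≤
        ; m^n>0; m∸n+n≡m; m≤m+n; m≤n⇒m≤1+n; n≤1+n; suc-injective; ≤-pred; ≤-refl; ≤-trans)
open import Data.Nat.Tactic.RingSolver using (solve-∀)
open import Data.Product using (Σ; ∃; _×_; _,_; proj₁)
open import Data.Product.Function.NonDependent.Propositional using (_×-⇔_)
open import Data.Sum using (_⊎_; inj₁; inj₂; [_,_])
open import Data.Sum.Function.Propositional using (_⊎-⇔_)
open import Data.Vec using (Vec; tabulate; toList)
import Data.Vec as Vec
import Data.Vec.Properties as Vec
open import Function using (id; _∘_; _⇔_; mk⇔; Equivalence)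
open import Function.Properties.Equivalence using () renaming (sym to ⇔-sym; trans to ⇔-trans)
open import Relation.Binary.PropositionalEquality
  using (_≡_; _≢_; refl; sym; trans; cong; cong₂; subst; subst₂; module ≡-Reasoning)
open import Relation.Nullary using (¬_; Dec; does; proof)
open import Relation.Nullary.Decidable using (True; toWitness; from-yes; ¬?; _⊎-dec_; _×-dec_)
open import Relation.Nullary.Reflects using (Reflects; ofʸ; ofⁿ)

double : ℕ → ℕ
double zero    = zero
double (suc n) = suc (suc (double n))

double≡2* : ∀ n → double n ≡ 2 * n
double≡2* zero    = refl
double≡2* (suc n) = cong suc (trans (cong suc (double≡2* n)) (sym (+-suc n (n + 0))))

double≡*2 : ∀ n → double n ≡ n * 2
double≡*2 n = trans (double≡2* n) (*-comm 2 n)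

n≤double : ∀ n → n ≤ double n
n≤double zero    = z≤n
n≤double (suc n) = s≤s (m≤n⇒m≤1+n (n≤double n))

data EvenOdd : ℕ → Set where
  even : ∀ k → EvenOdd (double k)
  odd  : ∀ k → EvenOdd (suc (double k))

evenOdd : ∀ n → EvenOdd n
evenOdd zero = even zero
evenOdd (suc n) with evenOdd n
... | even k = odd k
... | odd k  = even (suc k)

bitsFuel-irrelevant : ∀ f g m → m ≤ f → m ≤ g → bitsFuel f m ≡ bitsFuel g m
bitsFuel-irrelevant zero    zero    zero    _       _       = refl
bitsFuel-irrelevant zero    (suc g) zero    _       _       = refl
bitsFuel-irrelevant (suc f) zero    zero    _       _       = refl
bitsFuel-irrelevant (suc f) (suc g) zero    _       _       = refl
bitsFuel-irrelevant (suc f) (suc g) (suc m) (s≤s p) (s≤s q) =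
  cong (_ ∷_) (bitsFuel-irrelevant f g (suc m / 2) (≤-trans half≤m p) (≤-trans half≤m q))
  where
  half≤m : suc m / 2 ≤ m
  half≤m = ≤-pred (m/n<m (suc m) 2 (s≤s (s≤s z≤n)))

bitsFuel≡bits : ∀ f m → m ≤ f → bitsFuel f m ≡ bits m
bitsFuel≡bits f m m≤f = bitsFuel-irrelevant f m m m≤f ≤-refl

t-double : ∀ i → t (double i) ≡ t i
t-double zero    = refl
t-double (suc i) = begin
  t (double (suc i))
    ≡⟨⟩
  parity (((m % 2) ≡ᵇ 1) ∷ bitsFuel (suc (double i)) (m / 2))
    ≡⟨ cong₂ (λ r q → parity ((r ≡ᵇ 1) ∷ bitsFuel (suc (double i)) q)) rem quot ⟩
  parity (false ∷ bitsFuel (suc (double i)) (suc i))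
    ≡⟨ cong (parity ∘ (false ∷_)) (bitsFuel≡bits _ (suc i) (s≤s (n≤double i))) ⟩
  t (suc i) ∎
  where
  open ≡-Reasoning
  m = double (suc i)
  rem : m % 2 ≡ 0
  rem = trans (cong (_% 2) (double≡*2 (suc i))) (m*n%n≡0 (suc i) 2)
  quot : m / 2 ≡ suc i
  quot = trans (cong (_/ 2) (double≡*2 (suc i))) (m*n/n≡m (suc i) 2)

t-suc-double : ∀ i → t (suc (double i)) ≡ not (t i)
t-suc-double i = begin
  t (suc (double i))
    ≡⟨⟩
  parity (((m % 2) ≡ᵇ 1) ∷ bitsFuel (double i) (m / 2))
    ≡⟨ cong₂ (λ r q → parity ((r ≡ᵇ 1) ∷ bitsFuel (double i) q)) rem quot ⟩
  parity (true ∷ bitsFuel (double i) i)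
    ≡⟨ cong (parity ∘ (true ∷_)) (bitsFuel≡bits _ i (n≤double i)) ⟩
  not (t i) ∎
  where
  open ≡-Reasoning
  m = suc (double i)
  m≡1+i*2 : m ≡ 1 + i * 2
  m≡1+i*2 = cong suc (double≡*2 i)
  rem : m % 2 ≡ 1
  rem = trans (cong (_% 2) m≡1+i*2) ([m+kn]%n≡m%n 1 i 2)
  quot : m / 2 ≡ i
  quot = trans (cong (_/ 2) m≡1+i*2) (trans (+-distrib-/-∣ʳ 1 {d = 2} (divides i refl)) (m*n/n≡m i 2))

double-+ : ∀ a b → double (a + b) ≡ double a + double b
double-+ zero    b = refl
double-+ (suc a) b = cong (suc ∘ suc) (double-+ a b)

double-+-suc : ∀ a b → double a + suc (double b) ≡ suc (double (a + b))
double-+-suc a b = trans (+-suc (double a) (double b)) (cong suc (sym (double-+ a b)))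

double-injective : ∀ {a b} → double a ≡ double b → a ≡ b
double-injective {zero}  {zero}  _ = refl
double-injective {suc a} {suc b} e = cong suc (double-injective (suc-injective (suc-injective e)))

odd≢double : ∀ a b → suc (double a) ≢ double b
odd≢double zero    (suc b) ()
odd≢double (suc a) (suc b) e = odd≢double a b (suc-injective (suc-injective e))

t-alternates : ∀ i → t (suc (double i)) ≡ not (t (double i))
t-alternates i = trans (t-suc-double i) (cong not (sym (t-double i)))

t-no-aaa : ∀ q → t q ≡ t (suc q) → t (suc q) ≢ t (suc (suc q))
t-no-aaa q e e′ with evenOdd q
... | even k = not-¬ refl (trans e (t-alternates k))
... | odd k  = not-¬ refl (trans e′ (t-alternates (suc k)))

t-flip-at-block-boundary : ∀ k → t (double (suc k)) ≡ not (t (suc (double k))) → t k ≡ t (suc k)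
t-flip-at-block-boundary k e = begin
  t k                              ≡⟨ sym (not-involutive (t k)) ⟩
  not (not (t k))                  ≡⟨ cong not (sym (t-suc-double k)) ⟩
  not (t (suc (double k)))         ≡⟨ sym e ⟩
  t (double (suc k))               ≡⟨ t-double (suc k) ⟩
  t (suc k)                        ∎
  where open ≡-Reasoning

t-no-ababa : ∀ p → t (1 + p) ≡ not (t p) → t (2 + p) ≡ not (t (1 + p))
           → t (3 + p) ≡ not (t (2 + p)) → t (4 + p) ≡ not (t (3 + p)) → ⊥
t-no-ababa p e₁ e₂ e₃ e₄ with evenOdd p
... | even k = t-no-aaa k (t-flip-at-block-boundary k e₂) (t-flip-at-block-boundary (suc k) e₄)
... | odd k  = t-no-aaa k (t-flip-at-block-boundary k e₁) (t-flip-at-block-boundary (suc k) e₃)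

-- Windows of t and the Thue–Morse morphism

win : ℕ → ℕ → List Bool
win zero    i = []
win (suc n) i = t i ∷ win n (suc i)

rwin : ℕ → ℕ → List Bool
rwin zero    i = []
rwin (suc n) i = t (i + n) ∷ rwin n i

length-win : ∀ n i → length (win n i) ≡ n
length-win zero    i = refl
length-win (suc n) i = cong suc (length-win n (suc i))

win-snoc : ∀ n i → win (suc n) i ≡ win n i ++ t (i + n) ∷ []
win-snoc zero    i = cong (_∷ []) (cong t (sym (+-identityʳ i)))
win-snoc (suc n) i = cong (t i ∷_)
  (trans (win-snoc n (suc i)) (cong (λ k → win n (suc i) ++ t k ∷ []) (sym (+-suc i n))))

reverse-win : ∀ n i → reverse (win n i) ≡ rwin n i
reverse-win zero    i = refl
reverse-win (suc n) i = begin
  reverse (win (suc n) i)               ≡⟨ cong reverse (win-snoc n i) ⟩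
  reverse (win n i ++ t (i + n) ∷ [])   ≡⟨ reverse-++ (win n i) (t (i + n) ∷ []) ⟩
  t (i + n) ∷ reverse (win n i)         ≡⟨ cong (t (i + n) ∷_) (reverse-win n i) ⟩
  rwin (suc n) i                        ∎
  where open ≡-Reasoning

μ : List Bool → List Bool
μ []      = []
μ (x ∷ u) = x ∷ not x ∷ μ u

-- μ-inner u, μ-init u and μ-tail u are μ u without its two end letters, without its last
-- letter and without its first letter: the windows of t that cut through a block of μ.
μ-inner : List Bool → List Bool
μ-inner []          = []
μ-inner (x ∷ [])    = []
μ-inner (x ∷ y ∷ u) = not x ∷ y ∷ μ-inner (y ∷ u)

μ-init : List Bool → List Bool
μ-init []      = []
μ-init (x ∷ u) = x ∷ μ-inner (x ∷ u)

μ-tail : List Bool → List Bool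
μ-tail []      = []
μ-tail (x ∷ u) = not x ∷ μ u

win-μ : ∀ n i → win (double n) (double i) ≡ μ (win n i)
win-μ zero    i = refl
win-μ (suc n) i rewrite t-double i | t-suc-double i | win-μ n (suc i) = refl

win-μ-inner : ∀ n i → win (double n) (suc (double i)) ≡ μ-inner (win (suc n) i)
win-μ-inner zero    i = refl
win-μ-inner (suc n) i rewrite t-suc-double i | t-double (suc i) | win-μ-inner n (suc i) = refl

win-μ-init : ∀ n i → win (suc (double n)) (double i) ≡ μ-init (win (suc n) i)
win-μ-init n i rewrite t-double i | win-μ-inner n i = refl

win-μ-tail : ∀ n i → win (suc (double n)) (suc (double i)) ≡ μ-tail (win (suc n) i)
win-μ-tail n i rewrite t-suc-double i | win-μ n (suc i) = refl

complement : List Bool → List Bool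
complement = map not

rwin-μ : ∀ n i → rwin (double n) (double i) ≡ μ (complement (rwin n i))
rwin-μ zero    i = refl
rwin-μ (suc n) i
  rewrite double-+-suc i n | sym (double-+ i n) | t-suc-double (i + n) | t-double (i + n)
        | rwin-μ n i | not-involutive (t (i + n)) = refl

rwin-μ-inner : ∀ n i → rwin (double n) (suc (double i)) ≡ μ-inner (complement (rwin (suc n) i))
rwin-μ-inner zero    i = refl
rwin-μ-inner (suc n) i
  rewrite double-+-suc i n | sym (double-+ i n) | t-double (suc (i + n)) | t-suc-double (i + n)
        | rwin-μ-inner n i | +-suc i n | not-involutive (t (suc (i + n))) = refl

rwin-μ-tail : ∀ n i → rwin (suc (double n)) (double i) ≡ μ-tail (complement (rwin (suc n) i))
rwin-μ-tail n i rewrite sym (double-+ i n) | t-double (i + n) | rwin-μ n i | not-involutive (t (i + n)) = refl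

rwin-μ-init : ∀ n i → rwin (suc (double n)) (suc (double i)) ≡ μ-init (complement (rwin (suc n) i))
rwin-μ-init n i rewrite sym (double-+ i n) | t-suc-double (i + n) | rwin-μ-inner n i = refl

complement-involutive : ∀ u → complement (complement u) ≡ u
complement-involutive []      = refl
complement-involutive (x ∷ u) = cong₂ _∷_ (not-involutive x) (complement-involutive u)

μ-complement : ∀ u → μ (complement u) ≡ complement (μ u)
μ-complement []      = refl
μ-complement (x ∷ u) = cong (not x ∷_) (cong (not (not x) ∷_) (μ-complement u))

μ-inner-complement : ∀ u → μ-inner (complement u) ≡ complement (μ-inner u)
μ-inner-complement []          = refl
μ-inner-complement (x ∷ [])    = refl
μ-inner-complement (x ∷ y ∷ u) = cong (not (not x) ∷_) (cong (not y ∷_) (μ-inner-complement (y ∷ u)))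

μ-init-complement : ∀ u → μ-init (complement u) ≡ complement (μ-init u)
μ-init-complement []      = refl
μ-init-complement (x ∷ u) = cong (not x ∷_) (μ-inner-complement (x ∷ u))

μ-tail-complement : ∀ u → μ-tail (complement u) ≡ complement (μ-tail u)
μ-tail-complement []      = refl
μ-tail-complement (x ∷ u) = cong (not (not x) ∷_) (μ-complement u)

mirror : Bool → ℕ → ℕ → List Bool
mirror false n i = rwin n i
mirror true  n i = complement (rwin n i)

mirror-suc : ∀ c m q → mirror c (suc m) q ≡ (c xor t (q + m)) ∷ mirror c m q
mirror-suc false m q = refl
mirror-suc true  m q = refl

mirror-cong : ∀ c {n p i} → win n p ≡ win n i → mirror c n p ≡ mirror c n i
mirror-cong false {n} {p} {i} e = trans (sym (reverse-win n p)) (trans (cong reverse e) (reverse-win n i))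
mirror-cong true  e = cong complement (mirror-cong false e)

mirror-image : ∀ {F : List Bool → List Bool} → (∀ u → F (complement u) ≡ complement (F u))
             → ∀ c {m j n i} → rwin m j ≡ F (complement (rwin n i)) → mirror c m j ≡ F (mirror (not c) n i)
mirror-image F-complement false e = e
mirror-image {F} F-complement true {m} {j} {n} {i} e = begin
  complement (rwin m j)                   ≡⟨ cong complement e ⟩
  complement (F (complement (rwin n i)))  ≡⟨ cong complement (F-complement (rwin n i)) ⟩
  complement (complement (F (rwin n i)))  ≡⟨ complement-involutive (F (rwin n i)) ⟩
  F (rwin n i)                            ∎
  where open ≡-Reasoning

mirror-μ : ∀ c n i → mirror c (double n) (double i) ≡ μ (mirror (not c) n i)
mirror-μ c n i = mirror-image μ-complement c (rwin-μ n i)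

mirror-μ-inner : ∀ c n i → mirror c (double n) (suc (double i)) ≡ μ-inner (mirror (not c) (suc n) i)
mirror-μ-inner c n i = mirror-image μ-inner-complement c (rwin-μ-inner n i)

mirror-μ-tail : ∀ c n i → mirror c (suc (double n)) (double i) ≡ μ-tail (mirror (not c) (suc n) i)
mirror-μ-tail c n i = mirror-image μ-tail-complement c (rwin-μ-tail n i)

mirror-μ-init : ∀ c n i → mirror c (suc (double n)) (suc (double i)) ≡ μ-init (mirror (not c) (suc n) i)
mirror-μ-init c n i = mirror-image μ-init-complement c (rwin-μ-init n i)

μ-injective : ∀ {u v} → μ u ≡ μ v → u ≡ v
μ-injective {[]}    {[]}    _ = refl
μ-injective {x ∷ u} {y ∷ v} e = cong₂ _∷_ (∷-injectiveˡ e) (μ-injective (∷-injectiveʳ (∷-injectiveʳ e)))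

μ-inner-injectiveʳ : ∀ {x y u v} → x ≡ y → μ-inner (x ∷ u) ≡ μ-inner (y ∷ v) → x ∷ u ≡ y ∷ v
μ-inner-injectiveʳ {u = []}    {[]}    x≡y _ = cong (_∷ []) x≡y
μ-inner-injectiveʳ {u = _ ∷ _} {_ ∷ _} x≡y e =
  cong₂ _∷_ x≡y (μ-inner-injectiveʳ (∷-injectiveˡ (∷-injectiveʳ e)) (∷-injectiveʳ (∷-injectiveʳ e)))
μ-inner-injectiveʳ {u = []}    {_ ∷ _} _ ()
μ-inner-injectiveʳ {u = _ ∷ _} {[]}    _ ()

μ-inner-injective : ∀ {u v} → 2 ≤ length u → μ-inner u ≡ μ-inner v → u ≡ v
μ-inner-injective {x ∷ y ∷ u} {x′ ∷ y′ ∷ v} _ e =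
  cong₂ _∷_ (not-injective (∷-injectiveˡ e))
            (μ-inner-injectiveʳ (∷-injectiveˡ (∷-injectiveʳ e)) (∷-injectiveʳ (∷-injectiveʳ e)))
μ-inner-injective {_ ∷ _ ∷ _} {[]}     _ ()
μ-inner-injective {_ ∷ _ ∷ _} {_ ∷ []} _ ()
μ-inner-injective {_ ∷ []} (s≤s ()) _

μ-init-injective : ∀ {u v} → μ-init u ≡ μ-init v → u ≡ v
μ-init-injective {[]}    {[]}    _ = refl
μ-init-injective {x ∷ u} {y ∷ v} e = μ-inner-injectiveʳ (∷-injectiveˡ e) (∷-injectiveʳ e)

μ-tail-injective : ∀ {u v} → μ-tail u ≡ μ-tail v → u ≡ v
μ-tail-injective {[]}    {[]}    _ = refl
μ-tail-injective {x ∷ u} {y ∷ v} e =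
  cong₂ _∷_ (not-injective (∷-injectiveˡ e)) (μ-injective (∷-injectiveʳ e))

-- Synchronisation and the mirror closure

data Paired : List Bool → Set where
  nil  : Paired []
  one  : ∀ x → Paired (x ∷ [])
  pair : ∀ x {u} → Paired u → Paired (x ∷ not x ∷ u)

data OffsetPaired : List Bool → Set where
  nil  : OffsetPaired []
  skip : ∀ x {u} → Paired u → OffsetPaired (x ∷ u)

μ-paired : ∀ u → Paired (μ u)
μ-paired []      = nil
μ-paired (x ∷ u) = pair x (μ-paired u)

μ-tail-offsetPaired : ∀ u → OffsetPaired (μ-tail u)
μ-tail-offsetPaired []      = nil
μ-tail-offsetPaired (x ∷ u) = skip (not x) (μ-paired u)

win-even-paired : ∀ m i → Paired (win m (double i))
win-even-paired zero          i = nil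
win-even-paired (suc zero)    i = one _
win-even-paired (suc (suc m)) i =
  subst (λ y → Paired (t (double i) ∷ y ∷ win m (double (suc i))))
        (sym (t-alternates i)) (pair _ (win-even-paired m (suc i)))

win-odd-offsetPaired : ∀ m i → OffsetPaired (win m (suc (double i)))
win-odd-offsetPaired zero    i = nil
win-odd-offsetPaired (suc m) i = skip _ (win-even-paired m (suc i))

paired-offsetPaired-alternate : ∀ {a b c d e u}
  → Paired (a ∷ b ∷ c ∷ d ∷ e ∷ u) → OffsetPaired (a ∷ b ∷ c ∷ d ∷ e ∷ u)
  → b ≡ not a × c ≡ not b × d ≡ not c × e ≡ not d
paired-offsetPaired-alternate (pair _ (pair _ _)) (skip _ (pair _ (pair _ _))) = refl , refl , refl , refl

synchronise : ∀ {m} p → 5 ≤ m → Paired (win m p) → ¬ OffsetPaired (win m p)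
synchronise p (s≤s (s≤s (s≤s (s≤s (s≤s _))))) P O =
  let e₁ , e₂ , e₃ , e₄ = paired-offsetPaired-alternate P O in t-no-ababa p e₁ e₂ e₃ e₄

isOdd : ℕ → Bool
isOdd zero    = false
isOdd (suc k) = not (isOdd k)

isOdd-double : ∀ n → isOdd (double n) ≡ false
isOdd-double zero    = refl
isOdd-double (suc n) = cong (not ∘ not) (isOdd-double n)

xor-not-not : ∀ x y → x xor y ≡ not x xor not y
xor-not-not false y = sym (not-involutive y)
xor-not-not true  y = refl

-- 2^K − 1 − x complements the K lowest binary digits of x.
t-reflect : ∀ K x y → suc (x + y) ≡ 2 ^ K → t y ≡ isOdd K xor t x
t-reflect zero    zero    zero    _  = refl
t-reflect zero    zero    (suc y) ()
t-reflect zero    (suc x) y       ()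
t-reflect (suc K) x y e with evenOdd x | evenOdd y
... | even a | even b = ⊥-elim (odd≢double (a + b) (2 ^ K)
        (trans (cong suc (double-+ a b)) (trans e (sym (double≡2* (2 ^ K))))))
... | odd a  | odd b  = ⊥-elim (odd≢double (suc (a + b)) (2 ^ K)
        (trans (cong (suc ∘ suc) (sym (double-+-suc a b))) (trans e (sym (double≡2* (2 ^ K))))))
... | even a | odd b  = begin
  t (suc (double b))           ≡⟨ t-suc-double b ⟩
  not (t b)                    ≡⟨ cong not (t-reflect K a b (halve (cong suc (sym (double-+-suc a b))))) ⟩
  not (isOdd K xor t a)        ≡⟨ not-distribˡ-xor (isOdd K) (t a) ⟩
  not (isOdd K) xor t a        ≡⟨ cong (not (isOdd K) xor_) (sym (t-double a)) ⟩
  not (isOdd K) xor t (double a) ∎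
  where
  open ≡-Reasoning
  halve : double (suc (a + b)) ≡ suc (double a + suc (double b)) → suc (a + b) ≡ 2 ^ K
  halve d = double-injective (trans d (trans e (sym (double≡2* (2 ^ K)))))
... | odd a  | even b = begin
  t (double b)                 ≡⟨ t-double b ⟩
  t b                          ≡⟨ t-reflect K a b (halve (cong (suc ∘ suc) (double-+ a b))) ⟩
  isOdd K xor t a              ≡⟨ xor-not-not (isOdd K) (t a) ⟩
  not (isOdd K) xor not (t a)  ≡⟨ cong (not (isOdd K) xor_) (sym (t-suc-double a)) ⟩
  not (isOdd K) xor t (suc (double a)) ∎
  where
  open ≡-Reasoning
  halve : double (suc (a + b)) ≡ suc (suc (double a) + double b) → suc (a + b) ≡ 2 ^ K
  halve d = double-injective (trans d (trans e (sym (double≡2* (2 ^ K)))))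

mirror-zero : ∀ c q → mirror c 0 q ≡ []
mirror-zero false q = refl
mirror-zero true  q = refl

win-reflect : ∀ K m q q′ → q′ + (q + m) ≡ 2 ^ K → win m q′ ≡ mirror (isOdd K) m q
win-reflect K zero    q q′ _ = sym (mirror-zero (isOdd K) q)
win-reflect K (suc m) q q′ e = trans (cong₂ _∷_ first rest) (sym (mirror-suc (isOdd K) m q))
  where
  e′ : suc (q′ + (q + m)) ≡ 2 ^ K
  e′ = trans (sym (trans (cong (λ k → q′ + k) (+-suc q m)) (+-suc q′ (q + m)))) e
  first : t q′ ≡ isOdd K xor t (q + m)
  first = t-reflect K (q + m) q′ (trans (cong suc (+-comm (q + m) q′)) e′)
  rest : win m (suc q′) ≡ mirror (isOdd K) m q
  rest = win-reflect K m q (suc q′) e′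

n<2^n : ∀ n → n < 2 ^ n
n<2^n zero    = s≤s z≤n
n<2^n (suc n) = ≤-trans (s≤s (n<2^n n)) (+-mono-≤ (m^n>0 2 n) (m≤m+n (2 ^ n) 0))

exponentOfParity : Bool → ℕ → ℕ
exponentOfParity false n = double n
exponentOfParity true  n = suc (double n)

isOdd-exponentOfParity : ∀ c n → isOdd (exponentOfParity c n) ≡ c
isOdd-exponentOfParity false n = isOdd-double n
isOdd-exponentOfParity true  n = cong not (isOdd-double n)

n≤exponentOfParity : ∀ c n → n ≤ exponentOfParity c n
n≤exponentOfParity false n = n≤double n
n≤exponentOfParity true  n = m≤n⇒m≤1+n (n≤double n)

mirror-occurs : ∀ c m q → ∃ λ q′ → win m q′ ≡ mirror c m q
mirror-occurs c m q = 2 ^ K ∸ N ,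
  subst (λ b → win m (2 ^ K ∸ N) ≡ mirror b m q) (isOdd-exponentOfParity c N)
        (win-reflect K m q _ (m∸n+n≡m N≤2^K))
  where
  N = q + m
  K = exponentOfParity c N
  N≤2^K : N ≤ 2 ^ K
  N≤2^K = ≤-trans (<⇒≤ (n<2^n N)) (^-monoʳ-≤ 2 (n≤exponentOfParity c N))

record Classes {A : Set} (_~_ : A → A → Set) (k : ℕ) : Set where
  constructor classes
  field
    reps     : List A
    size     : length reps ≡ k
    distinct : AllPairs (λ x y → ¬ x ~ y) reps
    covers   : ∀ x → Any (x ~_) reps

classes-image : ∀ {A B : Set} {_~₀_ : A → A → Set} {_~_ : B → B → Set} {k} (f : A → B)
  → (∀ {x y} → f x ~ f y → x ~₀ y)
  → (∀ b → ∃ λ a → ∀ {x} → a ~₀ x → b ~ f x)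
  → Classes _~₀_ k → Classes _~_ k
classes-image f reflect cover (classes reps size distinct covers) = classes
  (map f reps)
  (trans (length-map f reps) size)
  (AllPairs.map⁺ (AllPairs.map (λ x≁y → x≁y ∘ reflect) distinct))
  (λ b → let a , a~⇒b~ = cover b in Any.map⁺ (Any.map a~⇒b~ (covers a)))

classes-union : ∀ {A B C : Set} {_~₁_ : A → A → Set} {_~₂_ : B → B → Set} {_~_ : C → C → Set} {k l}
  (f : A → C) (g : B → C)
  → (∀ x y → f x ~ f y ⇔ x ~₁ y) → (∀ x y → g x ~ g y ⇔ x ~₂ y) → (∀ x y → ¬ f x ~ g y)
  → (∀ c → (∃ λ a → c ≡ f a) ⊎ (∃ λ b → c ≡ g b))
  → Classes _~₁_ k → Classes _~₂_ l → Classes _~_ (k + l)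
classes-union {_~_ = _~_} f g f-embeds g-embeds disjoint split
  (classes reps₁ size₁ distinct₁ covers₁) (classes reps₂ size₂ distinct₂ covers₂) = classes
  (map f reps₁ ++ map g reps₂)
  (trans (length-++ (map f reps₁))
         (cong₂ _+_ (trans (length-map f reps₁) size₁) (trans (length-map g reps₂) size₂)))
  (AllPairs.++⁺ (AllPairs.map⁺ (AllPairs.map (λ x≁y → x≁y ∘ Equivalence.to (f-embeds _ _)) distinct₁))
                (AllPairs.map⁺ (AllPairs.map (λ x≁y → x≁y ∘ Equivalence.to (g-embeds _ _)) distinct₂))
                (All.map⁺ (All.universal (λ x → All.map⁺ (All.universal (disjoint x) reps₂)) reps₁)))
  cover
  where
  cover : ∀ c → Any (c ~_) (map f reps₁ ++ map g reps₂)
  cover c with split c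
  ... | inj₁ (a , refl) = Any.++⁺ˡ (Any.map⁺ (Any.map (Equivalence.from (f-embeds a _)) (covers₁ a)))
  ... | inj₂ (b , refl) =
    Any.++⁺ʳ (map f reps₁) (Any.map⁺ (Any.map (Equivalence.from (g-embeds b _)) (covers₂ b)))

-- Desubstitution recurrences

Same : ℕ → ℕ → ℕ → Set
Same n i j = win n i ≡ win n j

Mirrored : Bool → ℕ → ℕ → ℕ → Set
Mirrored c n i j = win n j ≡ mirror c n i

SameOrMirrored : Bool → ℕ → ℕ → ℕ → Set
SameOrMirrored c n i j = Same n i j ⊎ Mirrored c n i j

≡-via : ∀ (F : List Bool → List Bool) {a b x y}
      → (F x ≡ F y → x ≡ y) → a ≡ F x → b ≡ F y → (a ≡ b) ⇔ (x ≡ y)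
≡-via F injective a≡Fx b≡Fy = mk⇔
  (λ a≡b → injective (trans (sym a≡Fx) (trans a≡b b≡Fy)))
  (λ x≡y → trans a≡Fx (trans (cong F x≡y) (sym b≡Fy)))

two≤length-win : ∀ {n} → 1 ≤ n → ∀ i → 2 ≤ length (win (suc n) i)
two≤length-win 1≤n i = subst (2 ≤_) (sym (length-win _ i)) (s≤s 1≤n)

same-μ : ∀ n i j → Same (double n) (double i) (double j) ⇔ Same n i j
same-μ n i j = ≡-via μ μ-injective (win-μ n i) (win-μ n j)

same-μ-inner : ∀ {n} → 1 ≤ n → ∀ i j
             → Same (double n) (suc (double i)) (suc (double j)) ⇔ Same (suc n) i j
same-μ-inner {n} 1≤n i j =
  ≡-via μ-inner (μ-inner-injective (two≤length-win 1≤n i)) (win-μ-inner n i) (win-μ-inner n j)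

same-μ-init : ∀ n i j → Same (suc (double n)) (double i) (double j) ⇔ Same (suc n) i j
same-μ-init n i j = ≡-via μ-init μ-init-injective (win-μ-init n i) (win-μ-init n j)

same-μ-tail : ∀ n i j → Same (suc (double n)) (suc (double i)) (suc (double j)) ⇔ Same (suc n) i j
same-μ-tail n i j = ≡-via μ-tail μ-tail-injective (win-μ-tail n i) (win-μ-tail n j)

mirrored-μ : ∀ c n i j → Mirrored c (double n) (double i) (double j) ⇔ Mirrored (not c) n i j
mirrored-μ c n i j = ≡-via μ μ-injective (win-μ n j) (mirror-μ c n i)

mirrored-μ-inner : ∀ c {n} → 1 ≤ n → ∀ i j
  → Mirrored c (double n) (suc (double i)) (suc (double j)) ⇔ Mirrored (not c) (suc n) i j
mirrored-μ-inner c {n} 1≤n i j =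
  ≡-via μ-inner (μ-inner-injective (two≤length-win 1≤n j)) (win-μ-inner n j) (mirror-μ-inner c n i)

¬same-even-odd : ∀ {m} → 5 ≤ m → ∀ i j → ¬ Same m (double i) (suc (double j))
¬same-even-odd 5≤m i j e =
  synchronise (double i) 5≤m (win-even-paired _ i) (subst OffsetPaired (sym e) (win-odd-offsetPaired _ j))

¬mirrored-even-odd : ∀ c {n} → 5 ≤ double n → ∀ i j → ¬ Mirrored c (double n) (double i) (suc (double j))
¬mirrored-even-odd c {n} 5≤m i j e = synchronise (suc (double j)) 5≤m
  (subst Paired (sym (trans e (mirror-μ c n i))) (μ-paired _)) (win-odd-offsetPaired _ j)

¬mirrored-odd-even : ∀ c {n} → 5 ≤ suc (double n) → ∀ i j
                   → ¬ Mirrored c (suc (double n)) (double i) (double j)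
¬mirrored-odd-even c {n} 5≤m i j e = synchronise (double j) 5≤m
  (win-even-paired _ j) (subst OffsetPaired (sym (trans e (mirror-μ-tail c n i))) (μ-tail-offsetPaired _))

evenOdd-split : ∀ p → (∃ λ q → p ≡ double q) ⊎ (∃ λ q → p ≡ suc (double q))
evenOdd-split p with evenOdd p
... | even q = inj₁ (q , refl)
... | odd q  = inj₂ (q , refl)

five≤double : ∀ {n} → 3 ≤ n → 5 ≤ double n
five≤double (s≤s (s≤s (s≤s _))) = s≤s (s≤s (s≤s (s≤s (s≤s z≤n))))

five≤suc-double : ∀ {n} → 2 ≤ n → 5 ≤ suc (double n)
five≤suc-double (s≤s (s≤s _)) = s≤s (s≤s (s≤s (s≤s (s≤s z≤n))))

same-classes-double : ∀ {n a b} → 3 ≤ n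
  → Classes (Same n) a → Classes (Same (suc n)) b → Classes (Same (double n)) (a + b)
same-classes-double 3≤n = classes-union double (suc ∘ double)
  (same-μ _) (same-μ-inner (≤-trans (s≤s z≤n) 3≤n)) (¬same-even-odd (five≤double 3≤n)) evenOdd-split

same-classes-suc-double : ∀ {n b} → 2 ≤ n
  → Classes (Same (suc n)) b → Classes (Same (suc (double n))) (b + b)
same-classes-suc-double 2≤n C = classes-union double (suc ∘ double)
  (same-μ-init _) (same-μ-tail _) (¬same-even-odd (five≤suc-double 2≤n)) evenOdd-split C C

sameOrMirrored-classes-double : ∀ c {n a b} → 3 ≤ n
  → Classes (SameOrMirrored (not c) n) a → Classes (SameOrMirrored (not c) (suc n)) b
  → Classes (SameOrMirrored c (double n)) (a + b)
sameOrMirrored-classes-double c 3≤n = classes-union double (suc ∘ double)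
  (λ i j → same-μ _ i j ⊎-⇔ mirrored-μ c _ i j)
  (λ i j → same-μ-inner 1≤n i j ⊎-⇔ mirrored-μ-inner c 1≤n i j)
  (λ i j → [ ¬same-even-odd (five≤double 3≤n) i j , ¬mirrored-even-odd c (five≤double 3≤n) i j ])
  evenOdd-split
  where
  1≤n = ≤-trans (s≤s z≤n) 3≤n

-- At odd length, mirroring a window swaps the parity of its position, so the windows at even
-- positions already represent every class.
sameOrMirrored-classes-suc-double : ∀ c {n b} → 2 ≤ n
  → Classes (Same (suc n)) b → Classes (SameOrMirrored c (suc (double n))) b
sameOrMirrored-classes-suc-double c {n} 2≤n = classes-image double reflect cover
  where
  reflect : ∀ {i j} → SameOrMirrored c (suc (double n)) (double i) (double j) → Same (suc n) i j
  reflect (inj₁ same)     = Equivalence.to (same-μ-init n _ _) same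
  reflect (inj₂ mirrored) = ⊥-elim (¬mirrored-odd-even c (five≤suc-double 2≤n) _ _ mirrored)
  cover : ∀ p → ∃ λ q → ∀ {i} → Same (suc n) q i → SameOrMirrored c (suc (double n)) p (double i)
  cover p with evenOdd p
  ... | even q = q , inj₁ ∘ Equivalence.from (same-μ-init n q _)
  ... | odd q  = let q′ , q′-mirrors = mirror-occurs (not c) (suc n) q in
    q′ , λ {i} same → inj₂ (begin
      win (suc (double n)) (double i)          ≡⟨ win-μ-init n i ⟩
      μ-init (win (suc n) i)                   ≡⟨ cong μ-init (trans (sym same) q′-mirrors) ⟩
      μ-init (mirror (not c) (suc n) q)        ≡⟨ sym (mirror-μ-init c n q) ⟩
      mirror c (suc (double n)) (suc (double q)) ∎)
    where open ≡-Reasoning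

-- Small lengths, by search

take-win : ∀ {m n} → m ≤ n → ∀ i → take m (win n i) ≡ win m i
take-win z≤n       i = refl
take-win (s≤s m≤n) i = cong (t i ∷_) (take-win m≤n (suc i))

_≟ₗ_ : (u v : List Bool) → Dec (u ≡ v)
_≟ₗ_ = ≡-dec Data.Bool.Properties._≟_

-- The first occurrences of the ten factors of length 4.
firstOccurrences₄ : List ℕ
firstOccurrences₄ = 0 ∷ 1 ∷ 2 ∷ 3 ∷ 4 ∷ 5 ∷ 7 ∷ 9 ∷ 10 ∷ 11 ∷ []

occurs₄ : (u : List Bool) → {True (any? (λ i → u ≟ₗ win 4 i) firstOccurrences₄)}
        → Any (λ i → u ≡ win 4 i) firstOccurrences₄
occurs₄ u {found} = toWitness found

μ-occurs₄ : ∀ x y → Any (λ i → μ (x ∷ y ∷ []) ≡ win 4 i) firstOccurrences₄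
μ-occurs₄ false false = occurs₄ _
μ-occurs₄ false true  = occurs₄ _
μ-occurs₄ true  false = occurs₄ _
μ-occurs₄ true  true  = occurs₄ _

μ-inner-occurs₄ : ∀ x y z → (x ≡ y → y ≢ z)
                → Any (λ i → μ-inner (x ∷ y ∷ z ∷ []) ≡ win 4 i) firstOccurrences₄
μ-inner-occurs₄ false false false no-aaa = ⊥-elim (no-aaa refl refl)
μ-inner-occurs₄ false false true  _      = occurs₄ _
μ-inner-occurs₄ false true  false _      = occurs₄ _
μ-inner-occurs₄ false true  true  _      = occurs₄ _
μ-inner-occurs₄ true  false false _      = occurs₄ _
μ-inner-occurs₄ true  false true  _      = occurs₄ _
μ-inner-occurs₄ true  true  false _      = occurs₄ _
μ-inner-occurs₄ true  true  true  no-aaa = ⊥-elim (no-aaa refl refl)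

win₄-occurs : ∀ p → Any (λ i → win 4 p ≡ win 4 i) firstOccurrences₄
win₄-occurs p with evenOdd p
... | even q = Any.map (trans (win-μ 2 q)) (μ-occurs₄ (t q) (t (suc q)))
... | odd q  = Any.map (trans (win-μ-inner 2 q)) (μ-inner-occurs₄ (t q) (t (suc q)) (t (suc (suc q))) (t-no-aaa q))

classes-by-search : ∀ {R : ℕ → ℕ → Set} {m} → (R? : ∀ i j → Dec (R i j))
  → m ≤ 4 → (∀ p i j → Same m p i → R i j → R p j) → (L : List ℕ)
  → {True (allPairs? (λ i j → ¬? (R? i j)) L)} → {True (all? (λ i → any? (R? i) L) firstOccurrences₄)}
  → Classes R (length L)
classes-by-search {R} {m} R? m≤4 R-resp L {distinct} {found} = classes L refl (toWitness distinct) covers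
  where
  covers : ∀ p → Any (R p) L
  covers p = let i-reps , p~i = All.lookupAny (toWitness found) (win₄-occurs p) in
    Any.map (R-resp p _ _ (trans (sym (take-win m≤4 p)) (trans (cong (take m) p~i) (take-win m≤4 _)))) i-reps

same? : ∀ n i j → Dec (Same n i j)
same? n i j = win n i ≟ₗ win n j

sameOrMirrored? : ∀ c n i j → Dec (SameOrMirrored c n i j)
sameOrMirrored? c n i j = same? n i j ⊎-dec (win n j ≟ₗ mirror c n i)

sameOrMirrored-resp : ∀ c {m} p i j → Same m p i → SameOrMirrored c m i j → SameOrMirrored c m p j
sameOrMirrored-resp c p i j p~i (inj₁ same)     = inj₁ (trans p~i same)
sameOrMirrored-resp c p i j p~i (inj₂ mirrored) = inj₂ (trans mirrored (mirror-cong c (sym p~i)))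

ρ₁ : Classes (Same 1) 2
ρ₁ = classes-by-search (same? 1) (s≤s z≤n) (λ _ _ _ → trans)
  (0 ∷ 1 ∷ [])

ρ₂ : Classes (Same 2) 4
ρ₂ = classes-by-search (same? 2) (s≤s (s≤s z≤n)) (λ _ _ _ → trans)
  (0 ∷ 1 ∷ 2 ∷ 5 ∷ [])

ρ₃ : Classes (Same 3) 6
ρ₃ = classes-by-search (same? 3) (s≤s (s≤s (s≤s z≤n))) (λ _ _ _ → trans)
  (0 ∷ 1 ∷ 2 ∷ 3 ∷ 4 ∷ 5 ∷ [])

ρ₄ : Classes (Same 4) 10
ρ₄ = classes-by-search (same? 4) ≤-refl (λ _ _ _ → trans)
  firstOccurrences₄

r₀ : Classes (SameOrMirrored false 0) 1
r₀ = classes-by-search (sameOrMirrored? false 0) z≤n (sameOrMirrored-resp false)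
  (0 ∷ [])

r₁ : Classes (SameOrMirrored false 1) 2
r₁ = classes-by-search (sameOrMirrored? false 1) (s≤s z≤n) (sameOrMirrored-resp false)
  (0 ∷ 1 ∷ [])

r₂ : Classes (SameOrMirrored false 2) 3
r₂ = classes-by-search (sameOrMirrored? false 2) (s≤s (s≤s z≤n)) (sameOrMirrored-resp false)
  (0 ∷ 1 ∷ 5 ∷ [])

r₃ : Classes (SameOrMirrored false 3) 4
r₃ = classes-by-search (sameOrMirrored? false 3) (s≤s (s≤s (s≤s z≤n))) (sameOrMirrored-resp false)
  (0 ∷ 2 ∷ 3 ∷ 4 ∷ [])

r₄ : Classes (SameOrMirrored false 4) 6
r₄ = classes-by-search (sameOrMirrored? false 4) ≤-refl (sameOrMirrored-resp false)
  (0 ∷ 1 ∷ 2 ∷ 3 ∷ 4 ∷ 5 ∷ [])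

s₃ : Classes (SameOrMirrored true 3) 3
s₃ = classes-by-search (sameOrMirrored? true 3) (s≤s (s≤s (s≤s z≤n))) (sameOrMirrored-resp true)
  (0 ∷ 1 ∷ 2 ∷ [])

s₄ : Classes (SameOrMirrored true 4) 7
s₄ = classes-by-search (sameOrMirrored? true 4) ≤-refl (sameOrMirrored-resp true)
  (0 ∷ 1 ∷ 2 ∷ 5 ∷ 7 ∷ 9 ∷ 10 ∷ [])

record Census (n pal anti : ℕ) : Set where
  field
    ρ r s     : ℕ
    ρ-classes : Classes (Same n) ρ
    r-classes : Classes (SameOrMirrored false n) r
    s-classes : Classes (SameOrMirrored true n) s
    r-excess  : r + r ≡ ρ + pal
    s-excess  : s + s ≡ ρ + anti

open Census

sum-excess : ∀ x y X Y {p q} → x + x ≡ X + p → y + y ≡ Y + q → (x + y) + (x + y) ≡ (X + Y) + (p + q)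
sum-excess x y X Y {p} {q} ex ey = begin
  (x + y) + (x + y)   ≡⟨ interchange x y x y ⟩
  (x + x) + (y + y)   ≡⟨ cong₂ _+_ ex ey ⟩
  (X + p) + (Y + q)   ≡⟨ interchange X p Y q ⟩
  (X + Y) + (p + q)   ∎
  where
  open ≡-Reasoning
  interchange : ∀ a b c d → (a + b) + (c + d) ≡ (a + c) + (b + d)
  interchange = solve-∀

census-double : ∀ {n pal₀ anti₀ pal₁ anti₁} → 3 ≤ n
  → Census n pal₀ anti₀ → Census (suc n) pal₁ anti₁ → Census (double n) (anti₀ + anti₁) (pal₀ + pal₁)
census-double 3≤n C₀ C₁ = record
  { ρ = ρ C₀ + ρ C₁ ; r = s C₀ + s C₁ ; s = r C₀ + r C₁
  ; ρ-classes = same-classes-double 3≤n (ρ-classes C₀) (ρ-classes C₁)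
  ; r-classes = sameOrMirrored-classes-double false 3≤n (s-classes C₀) (s-classes C₁)
  ; s-classes = sameOrMirrored-classes-double true 3≤n (r-classes C₀) (r-classes C₁)
  ; r-excess = sum-excess (s C₀) (s C₁) (ρ C₀) (ρ C₁) (s-excess C₀) (s-excess C₁)
  ; s-excess = sum-excess (r C₀) (r C₁) (ρ C₀) (ρ C₁) (r-excess C₀) (r-excess C₁)
  }

census-suc-double : ∀ {n b} → 2 ≤ n → Classes (Same (suc n)) b → Census (suc (double n)) 0 0
census-suc-double {b = b} 2≤n C = record
  { ρ = b + b ; r = b ; s = b
  ; ρ-classes = same-classes-suc-double 2≤n C
  ; r-classes = sameOrMirrored-classes-suc-double false 2≤n C
  ; s-classes = sameOrMirrored-classes-suc-double true 2≤n C
  ; r-excess = sym (+-identityʳ (b + b))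
  ; s-excess = sym (+-identityʳ (b + b))
  }

-- The profile of n ≥ 3 consists of ρ (n+1) − ρ n, ρ (n+2) − ρ (n+1), the numbers
-- pal i = 2 r (n+i) − ρ (n+i) of palindromes and anti i = 2 s (n+i) − ρ (n+i) of factors equal to
-- their reversed complement.
record Profile : Set where
  constructor profile
  field Δρ₀ Δρ₁ pal₀ pal₁ pal₂ anti₀ anti₁ anti₂ : ℕ

record Tracks (n : ℕ) (P : Profile) : Set where
  open Profile P
  field
    C₀ : Census n pal₀ anti₀
    C₁ : Census (suc n) pal₁ anti₁
    C₂ : Census (suc (suc n)) pal₂ anti₂
    ρ-step₀ : ρ C₁ ≡ ρ C₀ + Δρ₀
    ρ-step₁ : ρ C₂ ≡ ρ C₁ + Δρ₁

open Tracks

-- From ρ (2n) = ρ n + ρ (n+1), ρ (2n+1) = 2 ρ (n+1), r (2n) = s n + s (n+1), s (2n) = r n + r (n+1)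
-- and r (2n+1) = s (2n+1) = ρ (n+1).
stepProfile : Bool → Profile → Profile
stepProfile false (profile d₀ d₁ p₀ p₁ p₂ a₀ a₁ a₂) =
  profile d₀ d₁ (a₀ + a₁) 0 (a₁ + a₂) (p₀ + p₁) 0 (p₁ + p₂)
stepProfile true  (profile d₀ d₁ p₀ p₁ p₂ a₀ a₁ a₂) =
  profile d₁ d₁ 0 (a₁ + a₂) 0 0 (p₁ + p₂) 0

gap-of-self-sum : ∀ x y d → y ≡ x + d → y + y ≡ (x + y) + d
gap-of-self-sum x y d refl = lemma x d
  where
  lemma : ∀ x d → (x + d) + (x + d) ≡ (x + (x + d)) + d
  lemma = solve-∀

gap-to-self-sum : ∀ x y d → y ≡ x + d → x + y ≡ (x + x) + d
gap-to-self-sum x y d refl = sym (+-assoc x x d)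

tracks-double : ∀ {n P} → 3 ≤ n → Tracks n P → Tracks (double n) (stepProfile false P)
tracks-double {P = profile d₀ d₁ _ _ _ _ _ _} 3≤n T = record
  { C₀ = census-double 3≤n (C₀ T) (C₁ T)
  ; C₁ = census-suc-double (≤-trans (n≤1+n 2) 3≤n) (ρ-classes (C₁ T))
  ; C₂ = census-double (m≤n⇒m≤1+n 3≤n) (C₁ T) (C₂ T)
  ; ρ-step₀ = gap-of-self-sum (ρ (C₀ T)) (ρ (C₁ T)) d₀ (ρ-step₀ T)
  ; ρ-step₁ = gap-to-self-sum (ρ (C₁ T)) (ρ (C₂ T)) d₁ (ρ-step₁ T)
  }

tracks-suc-double : ∀ {n P} → 3 ≤ n → Tracks n P → Tracks (suc (double n)) (stepProfile true P)
tracks-suc-double {P = profile d₀ d₁ _ _ _ _ _ _} 3≤n T = record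
  { C₀ = census-suc-double (≤-trans (n≤1+n 2) 3≤n) (ρ-classes (C₁ T))
  ; C₁ = census-double (m≤n⇒m≤1+n 3≤n) (C₁ T) (C₂ T)
  ; C₂ = census-suc-double (m≤n⇒m≤1+n (≤-trans (n≤1+n 2) 3≤n)) (ρ-classes (C₂ T))
  ; ρ-step₀ = gap-to-self-sum (ρ (C₁ T)) (ρ (C₂ T)) d₁ (ρ-step₁ T)
  ; ρ-step₁ = gap-of-self-sum (ρ (C₁ T)) (ρ (C₂ T)) d₁ (ρ-step₁ T)
  }

Upper : ℕ → ℕ → Set
Upper k n = 3 * 2 ^ k < n × n ≤ 4 * 2 ^ k

Lower : ℕ → ℕ → Set
Lower k n = 3 * 2 ^ k ≤ n × n < 4 * 2 ^ k

double-≤ : ∀ {a b} → double a ≤ double b ⇔ a ≤ b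
double-≤ = mk⇔ to from
  where
  to : ∀ {a b} → double a ≤ double b → a ≤ b
  to {zero}          _              = z≤n
  to {suc a} {suc b} (s≤s (s≤s le)) = s≤s (to le)
  from : ∀ {a b} → a ≤ b → double a ≤ double b
  from z≤n      = z≤n
  from (s≤s le) = s≤s (s≤s (from le))

double-≤-suc-double : ∀ {a b} → double a ≤ suc (double b) ⇔ a ≤ b
double-≤-suc-double = mk⇔ to from
  where
  to : ∀ {a b} → double a ≤ suc (double b) → a ≤ b
  to {zero}          _              = z≤n
  to {suc a} {suc b} (s≤s (s≤s le)) = s≤s (to le)
  to {suc a} {zero}  (s≤s ())
  from : ∀ {a b} → a ≤ b → double a ≤ suc (double b)
  from z≤n      = z≤n
  from (s≤s le) = s≤s (s≤s (from le))

suc-double-≤-double : ∀ {a b} → suc (double a) ≤ double b ⇔ a < b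
suc-double-≤-double {a} {zero}  = mk⇔ (λ ()) (λ ())
suc-double-≤-double {a} {suc b} = mk⇔ (λ { (s≤s le) → s≤s (Equivalence.to double-≤-suc-double le) })
                                      (λ { (s≤s le) → s≤s (Equivalence.from double-≤-suc-double le) })

*-2^suc : ∀ c k → c * 2 ^ suc k ≡ double (c * 2 ^ k)
*-2^suc c k = trans (lemma c (2 ^ k)) (sym (double≡2* (c * 2 ^ k)))
  where
  lemma : ∀ c p → c * (2 * p) ≡ 2 * (c * p)
  lemma = solve-∀

upper-double : ∀ k n → Upper (suc k) (double n) ⇔ Upper k n
upper-double k n rewrite *-2^suc 4 k | *-2^suc 3 k = suc-double-≤-double ×-⇔ double-≤

upper-suc-double : ∀ k n → Upper (suc k) (suc (double n)) ⇔ Lower k n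
upper-suc-double k n rewrite *-2^suc 4 k | *-2^suc 3 k = s≤s-⇔ double-≤ ×-⇔ suc-double-≤-double
  where
  s≤s-⇔ : ∀ {a b c d} → a ≤ b ⇔ c ≤ d → suc a ≤ suc b ⇔ c ≤ d
  s≤s-⇔ e = mk⇔ (Equivalence.to e ∘ ≤-pred) (s≤s ∘ Equivalence.from e)

lower-double : ∀ k n → Lower (suc k) (double n) ⇔ Lower k n
lower-double k n rewrite *-2^suc 4 k | *-2^suc 3 k = double-≤ ×-⇔ suc-double-≤-double

lower-suc-double : ∀ k n → Lower (suc k) (suc (double n)) ⇔ Lower k n
lower-suc-double k n rewrite *-2^suc 4 k | *-2^suc 3 k = double-≤-suc-double ×-⇔ double-≤ {suc n}

AtEven : (ℕ → ℕ → Set) → ℕ → Set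
AtEven I n = ∃ λ j → I (double j) n

AtOdd : (ℕ → ℕ → Set) → ℕ → Set
AtOdd I n = ∃ λ j → I (suc (double j)) n

atEven-shift : ∀ (I J : ℕ → ℕ → Set) {m n}
             → (∀ k → I (suc k) m ⇔ J k n) → ¬ I 0 m → AtEven I m ⇔ AtOdd J n
atEven-shift I J shift ¬I₀ = mk⇔
  (λ { (zero , i) → ⊥-elim (¬I₀ i) ; (suc j , i) → j , Equivalence.to (shift _) i })
  (λ (j , i) → suc j , Equivalence.from (shift _) i)

atOdd-shift : ∀ (I J : ℕ → ℕ → Set) {m n} → (∀ k → I (suc k) m ⇔ J k n) → AtOdd I m ⇔ AtEven J n
atOdd-shift I J shift = mk⇔ (λ (j , i) → j , Equivalence.to (shift _) i)
                            (λ (j , i) → j , Equivalence.from (shift _) i)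

¬upper-0 : ∀ {m} → 5 ≤ m → ¬ Upper 0 m
¬upper-0 5≤m (_ , m≤4) = <⇒≱ 5≤m m≤4

¬lower-0 : ∀ {m} → 4 ≤ m → ¬ Lower 0 m
¬lower-0 4≤m (_ , m<4) = <⇒≱ m<4 4≤m

reflects-⇔ : ∀ {A B : Set} {b} → A ⇔ B → Reflects A b → Reflects B b
reflects-⇔ A⇔B (ofʸ a)  = ofʸ (Equivalence.to A⇔B a)
reflects-⇔ A⇔B (ofⁿ ¬a) = ofⁿ (¬a ∘ Equivalence.from A⇔B)

record IntervalBits : Set where
  constructor intervalBits
  field evenUpper oddUpper evenLower oddLower : Bool

Located : ℕ → IntervalBits → Set
Located n (intervalBits eu ou el ol) =
  Reflects (AtEven Upper n) eu × Reflects (AtOdd Upper n) ou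
  × Reflects (AtEven Lower n) el × Reflects (AtOdd Lower n) ol

stepBits : Bool → IntervalBits → IntervalBits
stepBits false (intervalBits eu ou el ol) = intervalBits ou eu ol el
stepBits true  (intervalBits eu ou el ol) = intervalBits ol el ol el

located-double : ∀ {n B} → 3 ≤ n → Located n B → Located (double n) (stepBits false B)
located-double {n} {intervalBits _ _ _ _} 3≤n (eu , ou , el , ol) =
  reflects-⇔ (⇔-sym (atEven-shift Upper Upper (λ k → upper-double k n) (¬upper-0 5≤m))) ou ,
  reflects-⇔ (⇔-sym (atOdd-shift Upper Upper (λ k → upper-double k n))) eu ,
  reflects-⇔ (⇔-sym (atEven-shift Lower Lower (λ k → lower-double k n) (¬lower-0 4≤m))) ol ,
  reflects-⇔ (⇔-sym (atOdd-shift Lower Lower (λ k → lower-double k n))) el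
  where
  5≤m = five≤double 3≤n
  4≤m = ≤-trans (n≤1+n 4) 5≤m

located-suc-double : ∀ {n B} → 3 ≤ n → Located n B → Located (suc (double n)) (stepBits true B)
located-suc-double {n} {intervalBits _ _ _ _} 3≤n (eu , ou , el , ol) =
  reflects-⇔ (⇔-sym (atEven-shift Upper Lower (λ k → upper-suc-double k n) (¬upper-0 5≤m))) ol ,
  reflects-⇔ (⇔-sym (atOdd-shift Upper Lower (λ k → upper-suc-double k n))) el ,
  reflects-⇔ (⇔-sym (atEven-shift Lower Lower (λ k → lower-suc-double k n) (¬lower-0 4≤m))) ol ,
  reflects-⇔ (⇔-sym (atOdd-shift Lower Lower (λ k → lower-suc-double k n))) el
  where
  5≤m = five≤suc-double (≤-trans (n≤1+n 2) 3≤n)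
  4≤m = ≤-trans (n≤1+n 4) 5≤m

4^≡2^double : ∀ j → 4 ^ j ≡ 2 ^ double j
4^≡2^double zero    = refl
4^≡2^double (suc j) = trans (cong (4 *_) (4^≡2^double j)) (lemma (2 ^ double j))
  where
  lemma : ∀ x → 4 * x ≡ 2 * (2 * x)
  lemma = solve-∀

cond⇔atEvenUpper : ∀ n → Cond n ⇔ AtEven Upper n
cond⇔atEvenUpper n = mk⇔
  (λ (j , lo , hi) → j , subst (_≤ n) (trans (+-comm _ 1) (cong (suc ∘ (3 *_)) (4^≡2^double j))) lo ,
                         subst (n ≤_) (cong (4 *_) (4^≡2^double j)) hi)
  (λ (j , lo , hi) → j , subst (_≤ n) (sym (trans (+-comm _ 1) (cong (suc ∘ (3 *_)) (4^≡2^double j)))) lo ,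
                         subst (n ≤_) (sym (cong (4 *_) (4^≡2^double j))) hi)

-- The automaton

Fits : ℕ → Profile → IntervalBits → Set
Fits n P B = 3 ≤ n × Tracks n P × Located n B

bit : Bool → ℕ
bit b = if b then 1 else 0

appendDigit : ℕ → Bool → ℕ
appendDigit n b = 2 * n + bit b

appendDigit-false : ∀ n → appendDigit n false ≡ double n
appendDigit-false n = trans (+-identityʳ (2 * n)) (sym (double≡2* n))

appendDigit-true : ∀ n → appendDigit n true ≡ suc (double n)
appendDigit-true n = trans (+-comm (2 * n) 1) (cong suc (sym (double≡2* n)))

fits-step : ∀ b {n P B} → Fits n P B → Fits (appendDigit n b) (stepProfile b P) (stepBits b B)
fits-step false {n} {P} {B} (3≤n , T , L) =
  subst (λ m → Fits m (stepProfile false P) (stepBits false B)) (sym (appendDigit-false n))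
  (≤-trans 3≤n (n≤double n) , tracks-double 3≤n T , located-double 3≤n L)
fits-step true  {n} {P} {B} (3≤n , T , L) =
  subst (λ m → Fits m (stepProfile true P) (stepBits true B)) (sym (appendDigit-true n))
  (≤-trans 3≤n (m≤n⇒m≤1+n (n≤double n)) , tracks-suc-double 3≤n T , located-suc-double 3≤n L)

pattern q₀  = Fin.zero
pattern q₁  = Fin.suc q₀
pattern q₂  = Fin.suc q₁
pattern q₃  = Fin.suc q₂
pattern q₄  = Fin.suc q₃
pattern q₅  = Fin.suc q₄
pattern q₆  = Fin.suc q₅
pattern q₇  = Fin.suc q₆
pattern q₈  = Fin.suc q₇
pattern q₉  = Fin.suc q₈
pattern q₁₀ = Fin.suc q₉
pattern q₁₁ = Fin.suc q₁₀
pattern q₁₂ = Fin.suc q₁₁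
pattern q₁₃ = Fin.suc q₁₂

transition : Fin 14 → Bool → Fin 14
transition q₀  false = q₀
transition q₀  true  = q₁
transition q₁  false = q₂
transition q₁  true  = q₃
transition q₂  false = q₄
transition q₂  true  = q₅
transition q₃  false = q₆
transition q₃  true  = q₇
transition q₄  false = q₈
transition q₄  true  = q₅
transition q₅  false = q₉
transition q₅  true  = q₅
transition q₆  false = q₁₀
transition q₆  true  = q₁₁
transition q₇  false = q₁₂
transition q₇  true  = q₁₁
transition q₈  false = q₄
transition q₈  true  = q₅
transition q₉  false = q₉
transition q₉  true  = q₅
transition q₁₀ false = q₆
transition q₁₀ true  = q₇
transition q₁₁ false = q₁₃
transition q₁₁ true  = q₇
transition q₁₂ false = q₁₃
transition q₁₂ true  = q₇
transition q₁₃ false = q₁₂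
transition q₁₃ true  = q₁₁

output : Fin 14 → ℤ
output q₀  = + 1
output q₁  = + 1
output q₂  = + 1
output q₃  = + 2
output q₄  = + 0
output q₅  = + 4
output q₆  = + 0
output q₇  = + 3
output q₈  = -[1+ 0 ]
output q₉  = + 0
output q₁₀ = + 0
output q₁₁ = + 2
output q₁₂ = + 0
output q₁₃ = -[1+ 0 ]

automaton : DFAO (Fin 14)
automaton = record { init = q₀ ; δ = transition ; out = output }

-- q₀, q₁ and q₂ stand for n = 0, 1, 2, below the range of the recurrences.
profileOf : Fin 14 → Profile
profileOf q₃  = profile 4 2 2 2 0 0 4 0
profileOf q₄  = profile 2 4 2 0 4 4 0 4
profileOf q₅  = profile 4 4 0 4 0 0 4 0
profileOf q₆  = profile 4 2 4 0 4 4 0 2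
profileOf q₇  = profile 2 2 0 4 0 0 2 0
profileOf q₈  = profile 2 4 4 0 4 2 0 4
profileOf q₉  = profile 4 4 4 0 4 4 0 4
profileOf q₁₀ = profile 4 2 4 0 2 4 0 4
profileOf q₁₁ = profile 2 2 0 2 0 0 4 0
profileOf q₁₂ = profile 2 2 2 0 2 4 0 4
profileOf q₁₃ = profile 2 2 4 0 4 2 0 2
profileOf _   = profile 0 0 0 0 0 0 0 0

bitsOf : Fin 14 → IntervalBits
bitsOf q₃  = intervalBits false false true  false
bitsOf q₄  = intervalBits true  false false false
bitsOf q₅  = intervalBits false false false false
bitsOf q₆  = intervalBits false false false true
bitsOf q₇  = intervalBits false true  false true
bitsOf q₈  = intervalBits false true  false false
bitsOf q₉  = intervalBits false false false false
bitsOf q₁₀ = intervalBits false false true  false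
bitsOf q₁₁ = intervalBits true  false true  false
bitsOf q₁₂ = intervalBits true  false true  false
bitsOf q₁₃ = intervalBits false true  false true
bitsOf _   = intervalBits false false false false

Reaches : Fin 14 → ℕ → Set
Reaches q₀ n = n ≡ 0
Reaches q₁ n = n ≡ 1
Reaches q₂ n = n ≡ 2
Reaches q  n = Fits n (profileOf q) (bitsOf q)

census₃ : Census 3 2 0
census₃ = record
  { ρ = 6 ; r = 4 ; s = 3 ; ρ-classes = ρ₃ ; r-classes = r₃ ; s-classes = s₃ ; r-excess = refl ; s-excess = refl }

census₄ : Census 4 2 4
census₄ = record
  { ρ = 10 ; r = 6 ; s = 7 ; ρ-classes = ρ₄ ; r-classes = r₄ ; s-classes = s₄ ; r-excess = refl ; s-excess = refl }

census₅ : Census 5 0 0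
census₅ = census-suc-double ≤-refl ρ₃

census₆ : Census 6 4 4
census₆ = census-double ≤-refl census₃ census₄

census₇ : Census 7 0 0
census₇ = census-suc-double (n≤1+n 2) ρ₄

6≤3*2^suc : ∀ k → 6 ≤ 3 * 2 ^ suc k
6≤3*2^suc k = subst (6 ≤_) (sym (*-2^suc 3 k)) (Equivalence.from double-≤ (*-monoʳ-≤ 3 (m^n>0 2 k)))

¬upper-suc : ∀ k {m} → m ≤ 6 → ¬ Upper (suc k) m
¬upper-suc k m≤6 (lo , _) = <⇒≱ (≤-trans (s≤s (6≤3*2^suc k)) lo) m≤6

¬lower-suc : ∀ k {m} → m ≤ 5 → ¬ Lower (suc k) m
¬lower-suc k m≤5 (lo , _) = <⇒≱ (≤-trans (6≤3*2^suc k) lo) m≤5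

atEven-small : ∀ (I : ℕ → ℕ → Set) {m} → (∀ k → ¬ I (suc k) m) → AtEven I m ⇔ I 0 m
atEven-small I ¬I-suc = mk⇔ (λ { (zero , i) → i ; (suc j , i) → ⊥-elim (¬I-suc _ i) }) (λ i → 0 , i)

upper₀? : ∀ m → Dec (Upper 0 m)
upper₀? m = 3 <? m ×-dec m ≤? 4

lower₀? : ∀ m → Dec (Lower 0 m)
lower₀? m = 3 ≤? m ×-dec m <? 4

located-small : ∀ {m} → m ≤ 5 → Located m (intervalBits (does (upper₀? m)) false (does (lower₀? m)) false)
located-small {m} m≤5 =
  reflects-⇔ (⇔-sym (atEven-small Upper (λ k → ¬upper-suc k (m≤n⇒m≤1+n m≤5)))) (proof (upper₀? m)) ,
  ofⁿ (λ (j , i) → ¬upper-suc (double j) (m≤n⇒m≤1+n m≤5) i) ,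
  reflects-⇔ (⇔-sym (atEven-small Lower (λ k → ¬lower-suc k m≤5))) (proof (lower₀? m)) ,
  ofⁿ (λ (j , i) → ¬lower-suc (double j) m≤5 i)

fits₃ : Fits 3 (profileOf q₃) (bitsOf q₃)
fits₃ = ≤-refl
  , record { C₀ = census₃ ; C₁ = census₄ ; C₂ = census₅ ; ρ-step₀ = refl ; ρ-step₁ = refl }
  , located-small (s≤s (s≤s (s≤s z≤n)))

fits₄ : Fits 4 (profileOf q₄) (bitsOf q₄)
fits₄ = n≤1+n 3
  , record { C₀ = census₄ ; C₁ = census₅ ; C₂ = census₆ ; ρ-step₀ = refl ; ρ-step₁ = refl }
  , located-small (n≤1+n 4)

fits₅ : Fits 5 (profileOf q₅) (bitsOf q₅)
fits₅ = s≤s (s≤s (s≤s z≤n))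
  , record { C₀ = census₅ ; C₁ = census₆ ; C₂ = census₇ ; ρ-step₀ = refl ; ρ-step₁ = refl }
  , located-small ≤-refl

reaches-step : ∀ q b {n} → Reaches q n → Reaches (transition q b) (appendDigit n b)
reaches-step q₀  false refl = refl
reaches-step q₀  true  refl = refl
reaches-step q₁  false refl = refl
reaches-step q₁  true  refl = fits₃
reaches-step q₂  false refl = fits₄
reaches-step q₂  true  refl = fits₅
reaches-step q₃  false = fits-step false
reaches-step q₃  true  = fits-step true
reaches-step q₄  false = fits-step false
reaches-step q₄  true  = fits-step true
reaches-step q₅  false = fits-step false
reaches-step q₅  true  = fits-step true
reaches-step q₆  false = fits-step false
reaches-step q₆  true  = fits-step true
reaches-step q₇  false = fits-step false
reaches-step q₇  true  = fits-step true
reaches-step q₈  false = fits-step false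
reaches-step q₈  true  = fits-step true
reaches-step q₉  false = fits-step false
reaches-step q₉  true  = fits-step true
reaches-step q₁₀ false = fits-step false
reaches-step q₁₀ true  = fits-step true
reaches-step q₁₁ false = fits-step false
reaches-step q₁₁ true  = fits-step true
reaches-step q₁₂ false = fits-step false
reaches-step q₁₂ true  = fits-step true
reaches-step q₁₃ false = fits-step false
reaches-step q₁₃ true  = fits-step true

reachable : ∀ n → ∃ λ q → Reaches q n
reachable = <-rec _ reach
  where
  reach : ∀ n → (∀ {m} → m < n → ∃ λ q → Reaches q m) → ∃ λ q → Reaches q n
  reach n rec with evenOdd n
  ... | even zero    = q₀ , refl
  ... | even (suc k) = let q , h = rec (s≤s (s≤s (n≤double k))) in
    transition q false ,
    subst (Reaches (transition q false)) (appendDigit-false (suc k)) (reaches-step q false h)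
  ... | odd k        = let q , h = rec (s≤s (n≤double k)) in
    transition q true , subst (Reaches (transition q true)) (appendDigit-true k) (reaches-step q true h)

reaches-run : ∀ ds {q n} → Reaches q n → Reaches (foldl transition q ds) (foldl appendDigit n ds)
reaches-run []       h = h
reaches-run (b ∷ ds) {q} h = reaches-run ds (reaches-step q b h)

fits-of-reaches : ∀ q {n} → 3 ≤ n → Reaches q n → Fits n (profileOf q) (bitsOf q)
fits-of-reaches q₀ () refl
fits-of-reaches q₁ (s≤s ()) refl
fits-of-reaches q₂ (s≤s (s≤s ())) refl
fits-of-reaches (Fin.suc (Fin.suc (Fin.suc q))) _ h = h

fits-at : ∀ n → 3 ≤ n → ∃ λ q → Fits n (profileOf q) (bitsOf q)
fits-at n 3≤n = let q , h = reachable n in q , fits-of-reaches q 3≤n h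

anti-balanced : ∀ q → let P = profileOf q ; e = bit (IntervalBits.evenUpper (bitsOf q)) in
  Profile.anti₀ P + Profile.anti₁ P ≡ Profile.Δρ₀ P + (e + e)
anti-balanced = from-yes (Fin.all? λ q → let P = profileOf q ; e = bit (IntervalBits.evenUpper (bitsOf q)) in
  Profile.anti₀ P + Profile.anti₁ P ≟ Profile.Δρ₀ P + (e + e))

output-doubled : ∀ i → let q = Fin.suc (Fin.suc (Fin.suc i)) ; P = profileOf q in
  + 2 ℤ.* output q ≡ + (Profile.Δρ₀ P + Profile.pal₁ P) ℤ.- + Profile.pal₀ P
output-doubled = from-yes (Fin.all? λ i → let q = Fin.suc (Fin.suc (Fin.suc i)) ; P = profileOf q in
  + 2 ℤ.* output q ℤ.≟ + (Profile.Δρ₀ P + Profile.pal₁ P) ℤ.- + Profile.pal₀ P)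

double≡+ : ∀ n → double n ≡ n + n
double≡+ n = trans (double≡2* n) (cong (λ m → n + m) (+-identityʳ n))

self-sum-injective : ∀ {x y} → x + x ≡ y + y → x ≡ y
self-sum-injective {x} {y} e = double-injective (trans (double≡+ x) (trans e (sym (double≡+ y))))

half-of-sum : ∀ s₀ s₁ ρ₀ ρ₁ {a₀ a₁ d} e
            → s₀ + s₀ ≡ ρ₀ + a₀ → s₁ + s₁ ≡ ρ₁ + a₁ → ρ₁ ≡ ρ₀ + d
            → a₀ + a₁ ≡ d + (e + e) → s₀ + s₁ ≡ ρ₁ + e
half-of-sum s₀ s₁ ρ₀ _ {a₀} {a₁} {d} e e₀ e₁ refl balanced = self-sum-injective (begin
  (s₀ + s₁) + (s₀ + s₁)               ≡⟨ sum-excess s₀ s₁ ρ₀ (ρ₀ + d) e₀ e₁ ⟩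
  (ρ₀ + (ρ₀ + d)) + (a₀ + a₁)         ≡⟨ cong (λ a → (ρ₀ + (ρ₀ + d)) + a) balanced ⟩
  (ρ₀ + (ρ₀ + d)) + (d + (e + e))     ≡⟨ regroup ρ₀ d e ⟩
  ((ρ₀ + d) + e) + ((ρ₀ + d) + e)     ∎)
  where
  open ≡-Reasoning
  regroup : ∀ ρ d e → (ρ + (ρ + d)) + (d + (e + e)) ≡ ((ρ + d) + e) + ((ρ + d) + e)
  regroup = solve-∀

difference-from-excess : ∀ r₀ r₁ ρ₀ {ρ₁ pal₀ pal₁ d} (o : ℤ)
  → r₀ + r₀ ≡ ρ₀ + pal₀ → r₁ + r₁ ≡ ρ₁ + pal₁ → ρ₁ ≡ ρ₀ + d
  → + 2 ℤ.* o ≡ + (d + pal₁) ℤ.- + pal₀ → o ≡ + r₁ ℤ.- + r₀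
difference-from-excess r₀ r₁ ρ₀ {_} {pal₀} {pal₁} {d} o e₀ e₁ refl doubled =
  ℤ.*-cancelˡ-≡ (+ 2) o (+ r₁ ℤ.- + r₀) (begin
    + 2 ℤ.* o                                              ≡⟨ doubled ⟩
    + (d + pal₁) ℤ.- + pal₀                                ≡⟨ cong (ℤ._- + pal₀) (ℤ.pos-+ d pal₁) ⟩
    (+ d ℤ.+ + pal₁) ℤ.- + pal₀                            ≡⟨ cancel (+ ρ₀) (+ d) (+ pal₀) (+ pal₁) ⟩
    ((+ ρ₀ ℤ.+ + d) ℤ.+ + pal₁) ℤ.- (+ ρ₀ ℤ.+ + pal₀)
      ≡⟨ cong₂ ℤ._-_ (sym (embed r₁ (ρ₀ + d) pal₁ e₁)) (sym (embed r₀ ρ₀ pal₀ e₀)) ⟩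
    (+ r₁ ℤ.+ + r₁) ℤ.- (+ r₀ ℤ.+ + r₀)                    ≡⟨ halve (+ r₁) (+ r₀) ⟩
    + 2 ℤ.* (+ r₁ ℤ.- + r₀)                                ∎)
  where
  open ≡-Reasoning
  embed : ∀ r a b → r + r ≡ a + b → + r ℤ.+ + r ≡ + a ℤ.+ + b
  embed r a b e = trans (sym (ℤ.pos-+ r r)) (trans (cong +_ e) (ℤ.pos-+ a b))
  cancel : ∀ ρ d a₀ a₁ → (d ℤ.+ a₁) ℤ.- a₀ ≡ ((ρ ℤ.+ d) ℤ.+ a₁) ℤ.- (ρ ℤ.+ a₀)
  cancel = ℤ-solve-∀
  halve : ∀ x y → (x ℤ.+ x) ℤ.- (y ℤ.+ y) ≡ + 2 ℤ.* (x ℤ.- y)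
  halve = ℤ-solve-∀

odd-length-classes : ∀ n → Σ ℕ λ k
  → Classes (Same (suc n)) k × Classes (SameOrMirrored false (suc (double n))) k
odd-length-classes zero          = 2 , ρ₁ , r₁
odd-length-classes (suc zero)    = 4 , ρ₂ , r₃
odd-length-classes (suc (suc n)) =
  let _ , _ , T , _ = fits-at (3 + n) (s≤s (s≤s (s≤s z≤n))) in
  ρ (C₀ T) , ρ-classes (C₀ T) , sameOrMirrored-classes-suc-double false (s≤s (s≤s z≤n)) (ρ-classes (C₀ T))

even-length-classes : ∀ n → 2 ≤ n → Σ ℕ λ k → Classes (Same (suc n)) k
  × Σ Bool λ e → Reflects (AtEven Upper n) e × Classes (SameOrMirrored false (double n)) (k + bit e)
even-length-classes (suc zero) (s≤s ())
even-length-classes (suc (suc zero)) _ = 6 , ρ₃ , false , proj₁ (located-small (s≤s (s≤s z≤n))) , r₄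
even-length-classes (suc (suc (suc n))) _ =
  let q , 3≤n , T , L = fits-at (3 + n) (s≤s (s≤s (s≤s z≤n)))
      e = IntervalBits.evenUpper (bitsOf q) in
  ρ (C₁ T) , ρ-classes (C₁ T) , e , proj₁ L ,
  subst (Classes _) (half-of-sum (s (C₀ T)) (s (C₁ T)) (ρ (C₀ T)) (ρ (C₁ T)) (bit e)
                       (s-excess (C₀ T)) (s-excess (C₁ T)) (ρ-step₀ T) (anti-balanced q))
        (r-classes (census-double 3≤n (C₀ T) (C₁ T)))

difference-at : ∀ q {n} → Reaches q n → Σ ℕ λ a → Σ ℕ λ b
  → Classes (SameOrMirrored false n) a × Classes (SameOrMirrored false (suc n)) b × (output q ≡ + b - + a)
difference-at q₀ refl = 1 , 2 , r₀ , r₁ , refl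
difference-at q₁ refl = 2 , 3 , r₁ , r₂ , refl
difference-at q₂ refl = 3 , 4 , r₂ , r₃ , refl
difference-at q@(Fin.suc (Fin.suc (Fin.suc i))) (_ , T , _) =
  r (C₀ T) , r (C₁ T) , r-classes (C₀ T) , r-classes (C₁ T) ,
  difference-from-excess (r (C₀ T)) (r (C₁ T)) (ρ (C₀ T)) (output q)
                         (r-excess (C₀ T)) (r-excess (C₁ T)) (ρ-step₀ T) (output-doubled i)

toList-tabulate-t : ∀ n i (f : Fin n → Bool) → (∀ j → f j ≡ t (i + Fin.toℕ j))
                  → toList (tabulate f) ≡ win n i
toList-tabulate-t zero    i f _ = refl
toList-tabulate-t (suc n) i f f≡t = cong₂ _∷_ (trans (f≡t Fin.zero) (cong t (+-identityʳ i)))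
  (toList-tabulate-t n (suc i) (f ∘ Fin.suc) (λ j → trans (f≡t (Fin.suc j)) (cong t (+-suc i (Fin.toℕ j)))))

toList-window : ∀ n i → toList (window n i) ≡ win n i
toList-window n i = toList-tabulate-t n i _ (λ _ → refl)

toList-injective : ∀ {n} {xs ys : Vec Bool n} → toList xs ≡ toList ys → xs ≡ ys
toList-injective {xs = xs} e = trans (sym (Vec.cast-is-id refl xs)) (Vec.toList-injective refl xs _ e)

window-≡ : ∀ n i j → window n i ≡ window n j ⇔ Same n i j
window-≡ n i j = mk⇔
  (λ e → trans (sym (toList-window n i)) (trans (cong toList e) (toList-window n j)))
  (λ e → toList-injective (trans (toList-window n i) (trans e (sym (toList-window n j)))))

window-reverse : ∀ n i j → window n j ≡ Vec.reverse (window n i) ⇔ Mirrored false n i j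
window-reverse n i j = mk⇔
  (λ e → trans (sym (toList-window n j)) (trans (cong toList e) (trans (Vec.toList-reverse (window n i))
           (trans (cong reverse (toList-window n i)) (reverse-win n i)))))
  (λ e → toList-injective (trans (toList-window n j) (trans e (trans (sym (reverse-win n i))
           (trans (cong reverse (sym (toList-window n i))) (sym (Vec.toList-reverse (window n i))))))))

revEq⇔sameOrMirrored : ∀ n i j → RevEq (window n i) (window n j) ⇔ SameOrMirrored false n i j
revEq⇔sameOrMirrored n i j = ⇔-trans (window-≡ n j i) (mk⇔ sym sym) ⊎-⇔ window-reverse n i j

classes-⇔ : ∀ {A : Set} {_~_ _≈_ : A → A → Set} {k}
          → (∀ x y → x ~ y ⇔ x ≈ y) → Classes _≈_ k → Classes _~_ k
classes-⇔ ~⇔≈ = classes-image id (Equivalence.to (~⇔≈ _ _)) (λ x → x , Equivalence.from (~⇔≈ x _))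

classes⇒countClasses : ∀ {A B : Set} {_≈_ : A → A → Set} {k} (f : B → A)
  → Classes (λ i j → f i ≈ f j) k → CountClasses _≈_ (λ w → Σ B λ i → w ≡ f i) k
classes⇒countClasses f (classes reps size distinct covers) =
  map f reps , trans (length-map f reps) size , All.map⁺ (All.universal (λ i → i , refl) reps) ,
  AllPairs.map⁺ distinct , λ { w (p , refl) → Any.map⁺ (covers p) }

isRho : ∀ {n k} → Classes (Same n) k → IsRho n k
isRho {n} = classes⇒countClasses (window n) ∘ classes-⇔ (window-≡ n)

isR : ∀ {n k} → Classes (SameOrMirrored false n) k → IsR n k
isR {n} = classes⇒countClasses (window n) ∘ classes-⇔ (revEq⇔sameOrMirrored n)

count-odd-length : (n : ℕ) → Σ ℕ λ k → IsRho (n + 1) k × IsR (2 * n + 1) k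
count-odd-length n = let k , ρC , rC = odd-length-classes n in
  k , subst (λ m → IsRho m k) (+-comm 1 n) (isRho ρC) , subst (λ m → IsR m k) (sym (appendDigit-true n)) (isR rC)

count-even-length : (n : ℕ) → 2 ≤ n → Σ ℕ λ k → IsRho (n + 1) k
  × ((Cond n × IsR (2 * n) (k + 1)) ⊎ (¬ Cond n × IsR (2 * n) k))
count-even-length n 2≤n with even-length-classes n 2≤n
... | k , ρC , true  , ofʸ up  , rC = k , subst (λ m → IsRho m k) (+-comm 1 n) (isRho ρC) ,
  inj₁ (Equivalence.from (cond⇔atEvenUpper n) up , subst (λ m → IsR m (k + 1)) (double≡2* n) (isR rC))
... | k , ρC , false , ofⁿ ¬up , rC = k , subst (λ m → IsRho m k) (+-comm 1 n) (isRho ρC) ,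
  inj₂ (¬up ∘ Equivalence.to (cond⇔atEvenUpper n) , subst₂ IsR (double≡2* n) (+-identityʳ k) (isR rC))

automaton-outputs-difference : (ds : List Bool)
  → Σ ℕ λ a → Σ ℕ λ b → IsR (valueMsd ds) a × IsR (suc (valueMsd ds)) b
          × (DFAO.out automaton (run automaton ds) ≡ (+ b) - (+ a))
automaton-outputs-difference ds =
  let a , b , C , C′ , e = difference-at (run automaton ds) (reaches-run ds {q₀} refl) in a , b , isR C , isR C′ , e

theorem8p2 :
    ((n : ℕ) → Σ ℕ λ k → IsRho (n + 1) k × IsR (2 * n + 1) k)
    × ((n : ℕ) → 2 ≤ n → Σ ℕ λ k → IsRho (n + 1) k
        × ((Cond n × IsR (2 * n) (k + 1)) ⊎ (¬ Cond n × IsR (2 * n) k)))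
    × (Σ (DFAO (Fin 14)) λ M → (ds : List Bool) → Canonical ds →
        Σ ℕ λ a → Σ ℕ λ b → IsR (valueMsd ds) a × IsR (suc (valueMsd ds)) b
          × (DFAO.out M (run M ds) ≡ (+ b) - (+ a)))
-- Leading zeros keep the automaton in q₀ with value 0, so canonicity is not needed.
theorem8p2 = count-odd-length , count-even-length , automaton , λ ds _ → automaton-outputs-difference ds
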